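{- For every pair of positive integers $n_1,n_2$, the complete bipartite graph $K_{n_1,n_2}$ satisfies $\nu(K_{n_1,n_2})=2^{n_1+n_2-2}-1$, where $\nu(G)$ denotes the number of NAC-colourings of $G$ divided by $2$.
   Context: A NAC-colouring of a graph $G$ is a surjective map $c\colon E(G)\to\{\mathrm{red},\mathrm{blue}\}$ such that every cycle of $G$ is either monochromatic or contains at least two red and at least two blue edges. -}

module Defs where

open import Data.Nat using (ℕ; zero; suc; _+_; _*_; _≥_)
open import Data.Bool using (Bool; true; false)
open import Data.Fin using (Fin; zero; suc; inject₁; fromℕ; remQuot; _↑ˡ_; _↑ʳ_)
open import Data.Vec using (Vec; lookup)
open import Data.List using (List; length)
open import Data.List.Relation.Unary.Unique.Propositional using (Unique)
open import Data.List.Membership.Propositional using (_∈_)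
open import Data.Product using (Σ; ∃; ∃-syntax; _×_; _,_)
open import Data.Sum using (_⊎_)
open import Relation.Nullary using (¬_)
open import Relation.Binary.PropositionalEquality using (_≡_)
open import Function.Bundles using (_⇔_)
open import Function.Definitions using (Injective)

record Graph : Set where
  field
    nV   : ℕ
    nE   : ℕ
    ends : Fin nE → Fin nV × Fin nV

open Graph public

Joins : (G : Graph) → Fin (nE G) → Fin (nV G) → Fin (nV G) → Set
Joins G e u v = ends G e ≡ (u , v) ⊎ ends G e ≡ (v , u)

record Cycle (G : Graph) : Set where
  field
    len      : ℕ
    len≥3    : len ≥ 3
    vert     : Fin (suc len) → Fin (nV G)
    edge     : Fin len → Fin (nE G)
    closed   : vert (fromℕ len) ≡ vert zero
    vertDist : Injective _≡_ _≡_ (λ (i : Fin len) → vert (inject₁ i))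
    edgeDist : Injective _≡_ _≡_ edge
    joins    : (i : Fin len) → Joins G (edge i) (vert (inject₁ i)) (vert (suc i))

Colouring : Graph → Set
Colouring G = Vec Bool (nE G)

red blue : Bool
red = true
blue = false

colour : (G : Graph) → Colouring G → Fin (nE G) → Bool
colour G c e = lookup c e

AtLeastTwo : (G : Graph) → Colouring G → Cycle G → Bool → Set
AtLeastTwo G c C b = ∃[ i ] ∃[ j ] (¬ i ≡ j × colour G c (Cycle.edge C i) ≡ b × colour G c (Cycle.edge C j) ≡ b)

Monochromatic : (G : Graph) → Colouring G → Cycle G → Set
Monochromatic G c C = ∀ i j → colour G c (Cycle.edge C i) ≡ colour G c (Cycle.edge C j)

IsNAC : (G : Graph) → Colouring G → Set
IsNAC G c =
  (∃[ e ] colour G c e ≡ red) × (∃[ e ] colour G c e ≡ blue) ×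
  ((C : Cycle G) → Monochromatic G c C ⊎ (AtLeastTwo G c C red × AtLeastTwo G c C blue))

NACCount : Graph → ℕ → Set
NACCount G N = Σ (List (Colouring G)) λ cs →
  length cs ≡ N × Unique cs × ((c : Colouring G) → IsNAC G c ⇔ c ∈ cs)

-- Complete bipartite graph K_{n₁,n₂}: vertices Fin (n₁ + n₂) (first n₁ on one side),
-- one edge for each pair (i , j) ∈ Fin n₁ × Fin n₂.
K : ℕ → ℕ → Graph
K n₁ n₂ = record
  { nV = n₁ + n₂
  ; nE = n₁ * n₂
  ; ends = λ e → endsK (remQuot n₂ e)
  }
  where
  endsK : Fin n₁ × Fin n₂ → Fin (n₁ + n₂) × Fin (n₁ + n₂)
  endsK (i , j) = (i ↑ˡ n₂ , n₁ ↑ʳ j)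

{-# OPTIONS --safe #-}
module Submission where

-- Both colour classes of a colouring c(i,j) = p i xor q j of K_{n₁,n₂} are edge cuts (the
-- blue one is the cut of not ∘ p and q), and a cut meets every cycle in an even number of
-- edges, so such a colouring is NAC as soon as it uses both colours. Conversely, a NAC-colouring
-- of a 4-cycle has an even number of red edges, and the squares through the base edge (0,0)
-- force c(i,j) = c(i,0) xor c(0,0) xor c(0,j). So a NAC-colouring is determined by the colour a
-- of (0,0) together with the vector v ∈ 𝔽₂^(n₁+n₂-2) recording which other edges (i,0), (0,j)
-- of the star differ from a; it uses both colours iff v ≠ 0. This gives 2 (2^(n₁+n₂-2) - 1)
-- NAC-colourings.

open import Defs
open import Data.Nat using (ℕ; _+_; _*_; _∸_; _^_; _≥_; _/_)
open import Data.Product using (∃-syntax; _×_)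
open import Relation.Binary.PropositionalEquality using (_≡_)

open import Data.Bool using (Bool; true; false; not; _xor_; if_then_else_; _≟_)
open import Data.Bool.Properties
  using (xor-same; xor-assoc; xor-comm; xor-identityʳ; ¬-not; not-injective; not-distribˡ-xor)
open import Data.Empty using (⊥-elim)
open import Data.Fin using (Fin; zero; suc; inject₁; fromℕ; combine; remQuot; splitAt; _↑ˡ_; _↑ʳ_)
open import Data.Fin.Properties
  using ( suc-injective; 0≢1+n; any?; ↑ˡ-injective; ↑ʳ-injective
        ; splitAt-↑ˡ; splitAt-↑ʳ; splitAt⁻¹-↑ˡ; splitAt⁻¹-↑ʳ
        ; remQuot-combine; combine-remQuot; combine-injectiveˡ; combine-injectiveʳ )
open import Data.List using (List; []; _∷_; length; map; _++_; cartesianProductWith)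
open import Data.List.Properties using (length-++; length-map)
open import Data.List.Membership.Propositional using (_∈_)
open import Data.List.Membership.Propositional.Properties
  using (∈-map⁺; ∈-map⁻; ∈-++⁺ˡ; ∈-++⁺ʳ; ∈-++⁻; ∈-cartesianProductWith⁺; ∈-cartesianProductWith⁻)
open import Data.List.Relation.Unary.All using ([]; _∷_)
open import Data.List.Relation.Unary.AllPairs using ([]; _∷_)
open import Data.List.Relation.Unary.Any using (here; there)
open import Data.List.Relation.Unary.Unique.Propositional using (Unique)
open import Data.List.Relation.Unary.Unique.Propositional.Properties
  using (++⁺; map⁺; cartesianProductWith⁺)
open import Data.Nat using (zero; suc; _≤_; z≤n; s≤s; s≤s⁻¹)
open import Data.Nat.DivMod using (m*n/n≡m)
open import Data.Nat.Properties
  using ( ≤-refl; ≤-reflexive; ≤-trans; ≤-antisym; n≤1+n; +-monoʳ-≤; +-cancelʳ-≤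
        ; +-suc; +-assoc; +-identityʳ; *-comm; m+n∸n≡m )
open import Data.Product using (∃; _,_; proj₁; proj₂; uncurry)
open import Data.Product.Properties using (,-injectiveˡ; ,-injectiveʳ)
open import Data.Sum using (_⊎_; inj₁; inj₂; [_,_]′)
open import Data.Vec using (Vec; []; _∷_; lookup; tabulate)
open import Data.Vec.Properties
  using (lookup∘tabulate; tabulate∘lookup; tabulate-cong; ∷-injective; ∷-injectiveʳ)
open import Data.Vec.Relation.Unary.All using ([]; _∷_)
open import Data.Vec.Relation.Unary.AllPairs using ([]; _∷_)
import Data.Vec.Relation.Unary.Unique.Propositional as UniqueVec
open import Data.Vec.Relation.Unary.Unique.Propositional.Properties using (lookup-injective)
open import Function using (_∘_; id)
open import Function.Bundles using (mk⇔)
open import Relation.Nullary using (¬_; yes; no; contradiction)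
open import Relation.Binary.PropositionalEquality
  using (_≢_; refl; sym; trans; cong; cong₂; subst; module ≡-Reasoning)

xor-cancelˡ : ∀ x y → x xor (x xor y) ≡ y
xor-cancelˡ x y = trans (sym (xor-assoc x x y)) (cong (_xor y) (xor-same x))

xor-cancelʳ : ∀ x y → (x xor y) xor y ≡ x
xor-cancelʳ x y = trans (xor-assoc x y y) (trans (cong (x xor_) (xor-same y)) (xor-identityʳ x))

xor≡false⇒≡ : ∀ {x y} → x xor y ≡ false → x ≡ y
xor≡false⇒≡ {false} refl = refl
xor≡false⇒≡ {true} {true} _ = refl

trues : ∀ {n} → (Fin n → Bool) → ℕ
trues {zero}  g = 0
trues {suc n} g = (if g zero then suc else id) (trues (g ∘ suc))

odd : ℕ → Bool
odd zero    = false
odd (suc n) = not (odd n)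

odd-trues-suc : ∀ {n} (g : Fin (suc n) → Bool) →
  odd (trues g) ≡ g zero xor odd (trues (g ∘ suc))
odd-trues-suc g with g zero
... | true  = refl
... | false = refl

trues-cong : ∀ {n} {g h : Fin n → Bool} → (∀ k → g k ≡ h k) → trues g ≡ trues h
trues-cong {zero}  _   = refl
trues-cong {suc n} g≗h =
  cong₂ (λ b t → (if b then suc else id) t) (g≗h zero) (trues-cong (g≗h ∘ suc))

true⇒1≤trues : ∀ {n} (g : Fin n → Bool) {i} → g i ≡ true → 1 ≤ trues g
true⇒1≤trues g {zero} gi rewrite gi = s≤s z≤n
true⇒1≤trues g {suc i} gi with g zero
... | true  = s≤s z≤n
... | false = true⇒1≤trues (g ∘ suc) gi

1≤trues⇒∃true : ∀ {n} (g : Fin n → Bool) → 1 ≤ trues g → ∃ λ i → g i ≡ true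
1≤trues⇒∃true {suc n} g pos with g zero in g0
... | true  = zero , g0
... | false = let i , gi = 1≤trues⇒∃true (g ∘ suc) pos in suc i , gi

trues∘suc≤trues : ∀ {n} (g : Fin (suc n) → Bool) → trues (g ∘ suc) ≤ trues g
trues∘suc≤trues g with g zero
... | true  = n≤1+n _
... | false = ≤-refl

trues+trues∘not : ∀ {n} (g : Fin n → Bool) → trues g + trues (not ∘ g) ≡ n
trues+trues∘not {zero}  g = refl
trues+trues∘not {suc n} g with g zero
... | true  = cong suc (trues+trues∘not (g ∘ suc))
... | false = trans (+-suc _ _) (cong suc (trues+trues∘not (g ∘ suc)))

odd-trues-telescope : ∀ {n} (h : Fin (suc n) → Bool) →
  odd (trues (λ k → h (inject₁ k) xor h (suc k))) ≡ h zero xor h (fromℕ n)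
odd-trues-telescope {zero}  h = sym (xor-same (h zero))
odd-trues-telescope {suc n} h = begin
  odd (trues δ)
    ≡⟨ odd-trues-suc δ ⟩
  (h zero xor h (suc zero)) xor odd (trues (δ ∘ suc))
    ≡⟨ cong ((h zero xor h (suc zero)) xor_) (odd-trues-telescope (h ∘ suc)) ⟩
  (h zero xor h (suc zero)) xor (h (suc zero) xor h (fromℕ (suc n)))
    ≡⟨ xor-assoc (h zero) _ _ ⟩
  h zero xor (h (suc zero) xor (h (suc zero) xor h (fromℕ (suc n))))
    ≡⟨ cong (h zero xor_) (xor-cancelˡ (h (suc zero)) _) ⟩
  h zero xor h (fromℕ (suc n))
    ∎
  where
  open ≡-Reasoning
  δ : Fin (suc n) → Bool
  δ k = h (inject₁ k) xor h (suc k)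

TwoOf : ∀ {n} → Bool → (Fin n → Bool) → Set
TwoOf b g = ∃[ i ] ∃[ j ] (i ≢ j × g i ≡ b × g j ≡ b)

twoOf-true∘not⇒false : ∀ {n} {g : Fin n → Bool} → TwoOf true (not ∘ g) → TwoOf false g
twoOf-true∘not⇒false (i , j , i≢j , gi , gj) = i , j , i≢j , not-injective gi , not-injective gj

twoOf-false⇒true∘not : ∀ {n} {g : Fin n → Bool} → TwoOf false g → TwoOf true (not ∘ g)
twoOf-false⇒true∘not (i , j , i≢j , gi , gj) = i , j , i≢j , cong not gi , cong not gj

2≤trues⇒twoOf : ∀ {n} (g : Fin n → Bool) → 2 ≤ trues g → TwoOf true g
2≤trues⇒twoOf {suc n} g two with g zero in g0
... | true  = let j , gj = 1≤trues⇒∃true (g ∘ suc) (s≤s⁻¹ two)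
              in zero , suc j , (λ ()) , g0 , gj
... | false = let i , j , i≢j , gi , gj = 2≤trues⇒twoOf (g ∘ suc) two
              in suc i , suc j , i≢j ∘ suc-injective , gi , gj

twoOf⇒2≤trues : ∀ {n} (g : Fin n → Bool) → TwoOf true g → 2 ≤ trues g
twoOf⇒2≤trues g (zero  , zero  , 0≢0 , _)       = ⊥-elim (0≢0 refl)
twoOf⇒2≤trues g (zero  , suc j , _ , g0 , gj) rewrite g0 = s≤s (true⇒1≤trues (g ∘ suc) gj)
twoOf⇒2≤trues g (suc i , zero  , _ , gi , g0) rewrite g0 = s≤s (true⇒1≤trues (g ∘ suc) gi)
twoOf⇒2≤trues g (suc i , suc j , i≢j , gi , gj) =
  ≤-trans (twoOf⇒2≤trues (g ∘ suc) (i , j , i≢j ∘ cong suc , gi , gj)) (trues∘suc≤trues g)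

even⇒twoOf : ∀ {n} (g : Fin n → Bool) {i} → odd (trues g) ≡ false → g i ≡ true → TwoOf true g
even⇒twoOf g even gi = 2≤trues⇒twoOf g (at-least-two even (true⇒1≤trues g gi))
  where
  at-least-two : ∀ {t} → odd t ≡ false → 1 ≤ t → 2 ≤ t
  at-least-two {suc (suc t)} _ _ = s≤s (s≤s z≤n)

Constant : ∀ {n} → (Fin n → Bool) → Set
Constant g = ∀ i j → g i ≡ g j

constant : ∀ {n} {g : Fin n → Bool} {b} → (∀ k → g k ≡ b) → Constant g
constant g≡b i j = trans (g≡b i) (sym (g≡b j))

even⇒constant⊎twoOf : ∀ {n} (g : Fin n → Bool) →
  odd (trues g) ≡ false → odd (trues (not ∘ g)) ≡ false →
  Constant g ⊎ (TwoOf true g × TwoOf false g)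
even⇒constant⊎twoOf g even even-not
  with any? (λ k → g k ≟ true) | any? (λ k → g k ≟ false)
... | yes (i , gi) | yes (j , gj) =
  inj₂ ( even⇒twoOf g even gi
       , twoOf-true∘not⇒false (even⇒twoOf (not ∘ g) even-not (cong not gj)) )
... | no ∄true | _       = inj₁ (constant (λ k → ¬-not (∄true ∘ (k ,_))))
... | yes _ | no ∄false = inj₁ (constant (λ k → ¬-not (∄false ∘ (k ,_))))

constant⊎twoOf⇒even₄ : (g : Fin 4 → Bool) →
  Constant g ⊎ (TwoOf true g × TwoOf false g) → odd (trues g) ≡ false
constant⊎twoOf⇒even₄ g (inj₁ g-constant) =
  trans (cong odd (trues-cong (λ k → g-constant k zero))) (even-constant (g zero))
  where
  even-constant : ∀ b → odd (trues {4} (λ _ → b)) ≡ false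
  even-constant true  = refl
  even-constant false = refl
constant⊎twoOf⇒even₄ g (inj₂ (two-true , two-false)) = cong odd (≤-antisym t≤2 2≤t)
  where
  2≤t : 2 ≤ trues g
  2≤t = twoOf⇒2≤trues g two-true
  2≤t′ : 2 ≤ trues (not ∘ g)
  2≤t′ = twoOf⇒2≤trues (not ∘ g) (twoOf-false⇒true∘not two-false)
  t≤2 : trues g ≤ 2
  t≤2 = +-cancelʳ-≤ 2 (trues g) 2
          (≤-trans (+-monoʳ-≤ (trues g) 2≤t′) (≤-reflexive (trues+trues∘not g)))

IsCut : (G : Graph) → (Fin (nE G) → Bool) → Set
IsCut G col = ∃ λ (side : Fin (nV G) → Bool) →
  ∀ e → col e ≡ side (proj₁ (ends G e)) xor side (proj₂ (ends G e))

CycleCondition : (G : Graph) → Colouring G → Set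
CycleCondition G c =
  (C : Cycle G) → Monochromatic G c C ⊎ (AtLeastTwo G c C red × AtLeastTwo G c C blue)

cut⇒even : ∀ G {col} → IsCut G col → (C : Cycle G) → odd (trues (col ∘ Cycle.edge C)) ≡ false
cut⇒even G {col} (side , crosses) C = begin
  odd (trues (col ∘ edge))                        ≡⟨ cong odd (trues-cong along) ⟩
  odd (trues (λ k → h (inject₁ k) xor h (suc k))) ≡⟨ odd-trues-telescope h ⟩
  h zero xor h (fromℕ len)                        ≡⟨ cong (λ v → h zero xor side v) closed ⟩
  h zero xor h zero                               ≡⟨ xor-same (h zero) ⟩
  false                                           ∎
  where
  open ≡-Reasoning
  open Cycle C
  h : Fin (suc len) → Bool
  h = side ∘ vert
  along : ∀ k → col (edge k) ≡ h (inject₁ k) xor h (suc k)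
  along k with joins k
  ... | inj₁ ends≡ = trans (crosses (edge k)) (cong (λ (u , v) → side u xor side v) ends≡)
  ... | inj₂ ends≡ = trans (crosses (edge k))
                       (trans (cong (λ (u , v) → side u xor side v) ends≡) (xor-comm (h (suc k)) _))

cuts⇒cycleCondition : ∀ G (c : Colouring G) →
  IsCut G (colour G c) → IsCut G (not ∘ colour G c) → CycleCondition G c
cuts⇒cycleCondition G c red-cut blue-cut C =
  even⇒constant⊎twoOf (colour G c ∘ Cycle.edge C) (cut⇒even G red-cut C) (cut⇒even G blue-cut C)

bothColours : ∀ G (c : Colouring G) {e e′} a → colour G c e ≡ a → colour G c e′ ≡ not a →
  (∃[ e ] colour G c e ≡ red) × (∃[ e ] colour G c e ≡ blue)
bothColours G c true  ce ce′ = (_ , ce) , (_ , ce′)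
bothColours G c false ce ce′ = (_ , ce′) , (_ , ce)

module Bipartite (n₁ n₂ : ℕ) where

  private
    G : Graph
    G = K n₁ n₂

  left : Fin n₁ → Fin (n₁ + n₂)
  left i = i ↑ˡ n₂

  right : Fin n₂ → Fin (n₁ + n₂)
  right j = n₁ ↑ʳ j

  K-edge : Fin n₁ → Fin n₂ → Fin (n₁ * n₂)
  K-edge = combine

  K-edge⁻¹ : Fin (n₁ * n₂) → Fin n₁ × Fin n₂
  K-edge⁻¹ = remQuot n₂

  K-ends : ∀ i j → ends G (K-edge i j) ≡ (left i , right j)
  K-ends i j = cong (λ (i , j) → left i , right j) (remQuot-combine i j)

  K-colouring-ext : {c d : Colouring G} →
    (∀ i j → lookup c (K-edge i j) ≡ lookup d (K-edge i j)) → c ≡ d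
  K-colouring-ext {c} {d} agree = begin
    c                   ≡⟨ tabulate∘lookup c ⟨
    tabulate (lookup c) ≡⟨ tabulate-cong agree′ ⟩
    tabulate (lookup d) ≡⟨ tabulate∘lookup d ⟩
    d                   ∎
    where
    open ≡-Reasoning
    agree′ : ∀ e → lookup c e ≡ lookup d e
    agree′ e = subst (λ e → lookup c e ≡ lookup d e) (combine-remQuot {n₁} n₂ e)
                     (agree (proj₁ (K-edge⁻¹ e)) (proj₂ (K-edge⁻¹ e)))

  bicolouring : (Fin n₁ → Bool) → (Fin n₂ → Bool) → Colouring G
  bicolouring p q = tabulate (uncurry (λ i j → p i xor q j) ∘ K-edge⁻¹)

  lookup-bicolouring′ : ∀ p q e →
    lookup (bicolouring p q) e ≡ p (proj₁ (K-edge⁻¹ e)) xor q (proj₂ (K-edge⁻¹ e))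
  lookup-bicolouring′ p q = lookup∘tabulate (uncurry (λ i j → p i xor q j) ∘ K-edge⁻¹)

  lookup-bicolouring : ∀ p q i j → lookup (bicolouring p q) (K-edge i j) ≡ p i xor q j
  lookup-bicolouring p q i j =
    trans (lookup-bicolouring′ p q (K-edge i j))
          (cong (λ (i , j) → p i xor q j) (remQuot-combine i j))

  bicolouring-cycleCondition : ∀ p q → CycleCondition G (bicolouring p q)
  bicolouring-cycleCondition p q = cuts⇒cycleCondition G (bicolouring p q)
    (side p q , λ e → trans (lookup-bicolouring′ p q e) (crosses p q e))
    (side (not ∘ p) q , λ e →
      trans (cong not (lookup-bicolouring′ p q e))
            (trans (not-distribˡ-xor (p (proj₁ (K-edge⁻¹ e))) _) (crosses (not ∘ p) q e)))
    where
    side : (Fin n₁ → Bool) → (Fin n₂ → Bool) → Fin (n₁ + n₂) → Bool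
    side p q = [ p , q ]′ ∘ splitAt n₁
    crosses : ∀ p q e → let (i , j) = K-edge⁻¹ e in
      p i xor q j ≡ side p q (proj₁ (ends G e)) xor side p q (proj₂ (ends G e))
    crosses p q e = let (i , j) = K-edge⁻¹ e in
      sym (cong₂ _xor_ (cong [ p , q ]′ (splitAt-↑ˡ n₁ i n₂))
                       (cong [ p , q ]′ (splitAt-↑ʳ n₁ n₂ j)))

  left≢right : ∀ i j → left i ≢ right j
  left≢right i j eq
    with () ← trans (sym (splitAt-↑ˡ n₁ i n₂)) (trans (cong (splitAt n₁) eq) (splitAt-↑ʳ n₁ n₂ j))

  square : ∀ {i i′ j j′} → i ≢ i′ → j ≢ j′ → Cycle G
  square {i} {i′} {j} {j′} i≢i′ j≢j′ = record
    { len      = 4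
    ; len≥3    = s≤s (s≤s (s≤s z≤n))
    ; vert     = vert
    ; edge     = lookup edges
    ; closed   = refl
    ; vertDist = λ {x} {y} eq →
        lookup-injective corners-unique x y (trans (sym (corner x)) (trans eq (corner y)))
    ; edgeDist = λ {x} {y} → lookup-injective edges-unique x y
    ; joins    = joins
    }
    where
    corners : Vec (Fin (n₁ + n₂)) 4
    corners = left i ∷ right j ∷ left i′ ∷ right j′ ∷ []

    vert : Fin 5 → Fin (n₁ + n₂)
    vert zero                         = left i
    vert (suc zero)                   = right j
    vert (suc (suc zero))             = left i′
    vert (suc (suc (suc zero)))       = right j′
    vert (suc (suc (suc (suc zero)))) = left i

    corner : ∀ k → vert (inject₁ k) ≡ lookup corners k
    corner zero                   = refl
    corner (suc zero)             = refl
    corner (suc (suc zero))       = refl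
    corner (suc (suc (suc zero))) = refl

    corners-unique : UniqueVec.Unique corners
    corners-unique =
      (left≢right i j ∷ i≢i′ ∘ ↑ˡ-injective n₂ i i′ ∷ left≢right i j′ ∷ []) ∷
      (left≢right i′ j ∘ sym ∷ j≢j′ ∘ ↑ʳ-injective n₁ j j′ ∷ []) ∷
      (left≢right i′ j′ ∷ []) ∷ [] ∷ []

    edges : Vec (Fin (n₁ * n₂)) 4
    edges = K-edge i j ∷ K-edge i′ j ∷ K-edge i′ j′ ∷ K-edge i j′ ∷ []

    edges-unique : UniqueVec.Unique edges
    edges-unique =
      (i≢i′ ∘ index₁≡ ∷ i≢i′ ∘ index₁≡ ∷ j≢j′ ∘ index₂≡ ∷ []) ∷
      (j≢j′ ∘ index₂≡ ∷ i≢i′ ∘ sym ∘ index₁≡ ∷ []) ∷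
      (i≢i′ ∘ sym ∘ index₁≡ ∷ []) ∷ [] ∷ []
      where
      index₁≡ : ∀ {a b c d} → K-edge a b ≡ K-edge c d → a ≡ c
      index₁≡ = combine-injectiveˡ _ _ _ _
      index₂≡ : ∀ {a b c d} → K-edge a b ≡ K-edge c d → b ≡ d
      index₂≡ = combine-injectiveʳ {n₁} _ _ _ _

    joins : ∀ k → Joins G (lookup edges k) (vert (inject₁ k)) (vert (suc k))
    joins zero                   = inj₁ (K-ends i j)
    joins (suc zero)             = inj₂ (K-ends i′ j)
    joins (suc (suc zero))       = inj₁ (K-ends i′ j′)
    joins (suc (suc (suc zero))) = inj₂ (K-ends i j′)

  square-rule : ∀ {c} → CycleCondition G c → ∀ {i i′ j j′} → i ≢ i′ → j ≢ j′ →
    lookup c (K-edge i j) ≡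
      odd (trues (λ k → lookup c (lookup (K-edge i′ j ∷ K-edge i′ j′ ∷ K-edge i j′ ∷ []) k)))
  square-rule {c} cc i≢i′ j≢j′ =
    xor≡false⇒≡ (trans (sym (odd-trues-suc g)) (constant⊎twoOf⇒even₄ g (cc C)))
    where
    C : Cycle G
    C = square i≢i′ j≢j′
    g : Fin 4 → Bool
    g = colour G c ∘ Cycle.edge C

Nonzero : ∀ {k} → Vec Bool k → Set
Nonzero v = ∃ λ k → lookup v k ≡ true

bools : List Bool
bools = true ∷ false ∷ []

∈-bools : ∀ b → b ∈ bools
∈-bools true  = here refl
∈-bools false = there (here refl)

bools-unique : Unique bools
bools-unique = ((λ ()) ∷ []) ∷ [] ∷ []

length-cartesianProductWith : ∀ {A B C : Set} (f : A → B → C) xs ys →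
  length (cartesianProductWith f xs ys) ≡ length xs * length ys
length-cartesianProductWith f []       ys = refl
length-cartesianProductWith f (x ∷ xs) ys = trans (length-++ (map (f x) ys))
  (cong₂ _+_ (length-map (f x) ys) (length-cartesianProductWith f xs ys))

allVecs : ∀ k → List (Vec Bool k)
allVecs zero    = [] ∷ []
allVecs (suc k) = cartesianProductWith _∷_ bools (allVecs k)

allVecs-length : ∀ k → length (allVecs k) ≡ 2 ^ k
allVecs-length zero    = refl
allVecs-length (suc k) =
  trans (length-cartesianProductWith _∷_ bools (allVecs k)) (cong (2 *_) (allVecs-length k))

allVecs-complete : ∀ {k} (v : Vec Bool k) → v ∈ allVecs k
allVecs-complete []      = here refl
allVecs-complete (b ∷ v) = ∈-cartesianProductWith⁺ _∷_ (∈-bools b) (allVecs-complete v)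

allVecs-unique : ∀ k → Unique (allVecs k)
allVecs-unique zero    = [] ∷ []
allVecs-unique (suc k) = cartesianProductWith⁺ _∷_ ∷-injective bools-unique (allVecs-unique k)

nonzeroVecs : ∀ k → List (Vec Bool k)
nonzeroVecs zero    = []
nonzeroVecs (suc k) = map (true ∷_) (allVecs k) ++ map (false ∷_) (nonzeroVecs k)

nonzeroVecs-length : ∀ k → length (nonzeroVecs k) + 1 ≡ 2 ^ k
nonzeroVecs-length zero    = refl
nonzeroVecs-length (suc k) = begin
  length (map (true ∷_) (allVecs k) ++ map (false ∷_) (nonzeroVecs k)) + 1
    ≡⟨ cong (_+ 1) (length-++ (map (true ∷_) (allVecs k))) ⟩
  length (map (true ∷_) (allVecs k)) + length (map (false ∷_) (nonzeroVecs k)) + 1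
    ≡⟨ cong₂ (λ x y → x + y + 1) (length-map (true ∷_) (allVecs k))
                                 (length-map (false ∷_) (nonzeroVecs k)) ⟩
  length (allVecs k) + length (nonzeroVecs k) + 1
    ≡⟨ +-assoc (length (allVecs k)) _ 1 ⟩
  length (allVecs k) + (length (nonzeroVecs k) + 1)
    ≡⟨ cong₂ _+_ (allVecs-length k) (nonzeroVecs-length k) ⟩
  2 ^ k + 2 ^ k
    ≡⟨ cong (2 ^ k +_) (+-identityʳ (2 ^ k)) ⟨
  2 ^ suc k
    ∎
  where open ≡-Reasoning

nonzeroVecs-complete : ∀ {k} (v : Vec Bool k) → Nonzero v → v ∈ nonzeroVecs k
nonzeroVecs-complete {suc k} (true ∷ v) _ = ∈-++⁺ˡ (∈-map⁺ (true ∷_) (allVecs-complete v))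
nonzeroVecs-complete {suc k} (false ∷ v) (suc i , vi) =
  ∈-++⁺ʳ (map (true ∷_) (allVecs k)) (∈-map⁺ (false ∷_) (nonzeroVecs-complete v (i , vi)))

nonzeroVecs-sound : ∀ {k} (v : Vec Bool k) → v ∈ nonzeroVecs k → Nonzero v
nonzeroVecs-sound {suc k} v v∈ with ∈-++⁻ (map (true ∷_) (allVecs k)) v∈
... | inj₁ v∈ˡ with _ , _ , refl ← ∈-map⁻ (true ∷_) v∈ˡ = zero , refl
... | inj₂ v∈ʳ with w , w∈ , refl ← ∈-map⁻ (false ∷_) v∈ʳ =
  let i , wi = nonzeroVecs-sound w w∈ in suc i , wi

nonzeroVecs-unique : ∀ k → Unique (nonzeroVecs k)
nonzeroVecs-unique zero    = []
nonzeroVecs-unique (suc k) =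
  ++⁺ (map⁺ ∷-injectiveʳ (allVecs-unique k)) (map⁺ ∷-injectiveʳ (nonzeroVecs-unique k)) disjoint
  where
  disjoint : ∀ {v} → ¬ (v ∈ map (true ∷_) (allVecs k) × v ∈ map (false ∷_) (nonzeroVecs k))
  disjoint (v∈ˡ , v∈ʳ)
    with _ , _ , refl ← ∈-map⁻ (true ∷_) v∈ˡ | _ , _ , () ← ∈-map⁻ (false ∷_) v∈ʳ

module NormalForm (m₁ m₂ : ℕ) where

  open Bipartite (suc m₁) (suc m₂)

  private
    G : Graph
    G = K (suc m₁) (suc m₂)

  base : Fin (suc m₁ * suc m₂)
  base = K-edge zero zero

  star : Fin (m₁ + m₂) → Fin (suc m₁ * suc m₂)
  star = [ (λ i → K-edge (suc i) zero) , (λ j → K-edge zero (suc j)) ]′ ∘ splitAt m₁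

  determined-by-star : ∀ {c d} → CycleCondition G c → CycleCondition G d →
    lookup c base ≡ lookup d base → (∀ k → lookup c (star k) ≡ lookup d (star k)) → c ≡ d
  determined-by-star {c} {d} cc cd base≡ star≡ = K-colouring-ext agree
    where
    agree-left : ∀ i → lookup c (K-edge i zero) ≡ lookup d (K-edge i zero)
    agree-left zero    = base≡
    agree-left (suc i) = subst (λ e → lookup c e ≡ lookup d e)
                               (cong [ _ , _ ]′ (splitAt-↑ˡ m₁ i m₂)) (star≡ (i ↑ˡ m₂))
    agree-right : ∀ j → lookup c (K-edge zero j) ≡ lookup d (K-edge zero j)
    agree-right zero    = base≡
    agree-right (suc j) = subst (λ e → lookup c e ≡ lookup d e)
                                (cong [ _ , _ ]′ (splitAt-↑ʳ m₁ m₂ j)) (star≡ (m₁ ↑ʳ j))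
    agree : ∀ i j → lookup c (K-edge i j) ≡ lookup d (K-edge i j)
    agree zero    j       = agree-right j
    agree (suc i) zero    = agree-left (suc i)
    agree (suc i) (suc j) = begin
      lookup c (K-edge (suc i) (suc j))
        ≡⟨ square-rule {c} cc (0≢1+n ∘ sym) (0≢1+n ∘ sym) ⟩
      odd (trues (λ k → lookup c (lookup others k)))
        ≡⟨ cong odd (trues-cong others-agree) ⟩
      odd (trues (λ k → lookup d (lookup others k)))
        ≡⟨ square-rule {d} cd (0≢1+n ∘ sym) (0≢1+n ∘ sym) ⟨
      lookup d (K-edge (suc i) (suc j))
        ∎
      where
      open ≡-Reasoning
      others : Vec (Fin (suc m₁ * suc m₂)) 3
      others = K-edge zero (suc j) ∷ K-edge zero zero ∷ K-edge (suc i) zero ∷ []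
      others-agree : ∀ k → lookup c (lookup others k) ≡ lookup d (lookup others k)
      others-agree zero             = agree-right (suc j)
      others-agree (suc zero)       = base≡
      others-agree (suc (suc zero)) = agree-left (suc i)

  leftLabel : Vec Bool (m₁ + m₂) → Fin (suc m₁) → Bool
  leftLabel v zero    = false
  leftLabel v (suc i) = lookup v (i ↑ˡ m₂)

  rightLabel : Bool → Vec Bool (m₁ + m₂) → Fin (suc m₂) → Bool
  rightLabel a v zero    = a
  rightLabel a v (suc j) = lookup v (m₁ ↑ʳ j) xor a

  colouringOf : Bool → Vec Bool (m₁ + m₂) → Colouring G
  colouringOf a v = bicolouring (leftLabel v) (rightLabel a v)

  parametersOf : Colouring G → Bool × Vec Bool (m₁ + m₂)
  parametersOf c = lookup c base , tabulate (λ k → lookup c (star k) xor lookup c base)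

  colouringOf-base : ∀ a v → lookup (colouringOf a v) base ≡ a
  colouringOf-base a v = lookup-bicolouring (leftLabel v) (rightLabel a v) zero zero

  colouringOf-star : ∀ a v k → lookup (colouringOf a v) (star k) ≡ lookup v k xor a
  colouringOf-star a v k with splitAt m₁ k in split≡
  ... | inj₁ i = trans (lookup-bicolouring (leftLabel v) (rightLabel a v) (suc i) zero)
                       (cong (λ k → lookup v k xor a) (splitAt⁻¹-↑ˡ split≡))
  ... | inj₂ j = trans (lookup-bicolouring (leftLabel v) (rightLabel a v) zero (suc j))
                       (cong (λ k → lookup v k xor a) (splitAt⁻¹-↑ʳ split≡))

  colouringOf-constant : ∀ a {v} → (∀ k → lookup v k ≡ false) → ∀ e → lookup (colouringOf a v) e ≡ a
  colouringOf-constant a {v} v≡0 e =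
    trans (lookup-bicolouring′ (leftLabel v) (rightLabel a v) e)
          (cong₂ _xor_ (left≡false (proj₁ (K-edge⁻¹ e))) (right≡a (proj₂ (K-edge⁻¹ e))))
    where
    left≡false : ∀ i → leftLabel v i ≡ false
    left≡false zero    = refl
    left≡false (suc i) = v≡0 (i ↑ˡ m₂)
    right≡a : ∀ j → rightLabel a v j ≡ a
    right≡a zero    = refl
    right≡a (suc j) = cong (_xor a) (v≡0 (m₁ ↑ʳ j))

  parametersOf-colouringOf : ∀ a v → parametersOf (colouringOf a v) ≡ (a , v)
  parametersOf-colouringOf a v = cong₂ _,_ (colouringOf-base a v) (begin
    tabulate (λ k → lookup c (star k) xor lookup c base) ≡⟨ tabulate-cong relative ⟩
    tabulate (lookup v)                                  ≡⟨ tabulate∘lookup v ⟩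
    v                                                    ∎)
    where
    open ≡-Reasoning
    c : Colouring G
    c = colouringOf a v
    relative : ∀ k → lookup c (star k) xor lookup c base ≡ lookup v k
    relative k = trans (cong₂ _xor_ (colouringOf-star a v k) (colouringOf-base a v))
                       (xor-cancelʳ (lookup v k) a)

  colouringOf-injective : ∀ {a b v w} → colouringOf a v ≡ colouringOf b w → a ≡ b × v ≡ w
  colouringOf-injective {a} {b} {v} {w} eq = ,-injectiveˡ av≡bw , ,-injectiveʳ av≡bw
    where
    av≡bw : (a , v) ≡ (b , w)
    av≡bw = trans (sym (parametersOf-colouringOf a v))
                  (trans (cong parametersOf eq) (parametersOf-colouringOf b w))

  colouringOf-cycleCondition : ∀ a v → CycleCondition G (colouringOf a v)
  colouringOf-cycleCondition a v = bicolouring-cycleCondition (leftLabel v) (rightLabel a v)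

  colouringOf-isNAC : ∀ a {v} → Nonzero v → IsNAC G (colouringOf a v)
  colouringOf-isNAC a {v} (k , vk) =
    let red , blue = bothColours G (colouringOf a v) {base} {star k} a (colouringOf-base a v)
                                 (trans (colouringOf-star a v k) (cong (_xor a) vk))
    in red , blue , colouringOf-cycleCondition a v

  cycleCondition⇒colouringOf : ∀ {c} → CycleCondition G c →
    c ≡ colouringOf (proj₁ (parametersOf c)) (proj₂ (parametersOf c))
  cycleCondition⇒colouringOf {c} cc =
    determined-by-star cc (colouringOf-cycleCondition a v) (sym (colouringOf-base a v)) star≡
    where
    a : Bool
    a = proj₁ (parametersOf c)
    v : Vec Bool (m₁ + m₂)
    v = proj₂ (parametersOf c)
    star≡ : ∀ k → lookup c (star k) ≡ lookup (colouringOf a v) (star k)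
    star≡ k = sym (begin
      lookup (colouringOf a v) (star k) ≡⟨ colouringOf-star a v k ⟩
      lookup v k xor a                  ≡⟨ cong (_xor a) (lookup∘tabulate (λ k → lookup c (star k) xor a) k) ⟩
      (lookup c (star k) xor a) xor a   ≡⟨ xor-cancelʳ _ a ⟩
      lookup c (star k)                 ∎)
      where open ≡-Reasoning

  isNAC⇒nonzero : ∀ {c} → IsNAC G c → Nonzero (proj₂ (parametersOf c))
  isNAC⇒nonzero {c} ((e , ce) , (e′ , ce′) , cc)
    with any? (λ k → lookup (proj₂ (parametersOf c)) k ≟ true)
  ... | yes nonzero = nonzero
  ... | no ¬nonzero =
    contradiction (trans (sym ce) (trans (≡base e) (trans (sym (≡base e′)) ce′))) λ ()
    where
    ≡base : ∀ e → lookup c e ≡ proj₁ (parametersOf c)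
    ≡base e = trans (cong (λ d → lookup d e) (cycleCondition⇒colouringOf {c} cc))
                    (colouringOf-constant _ (λ k → ¬-not (¬nonzero ∘ (k ,_))) e)

  nacColourings : List (Colouring G)
  nacColourings = cartesianProductWith colouringOf bools (nonzeroVecs (m₁ + m₂))

  isNAC⇒∈ : ∀ {c} → IsNAC G c → c ∈ nacColourings
  isNAC⇒∈ {c} nac@(_ , _ , cc) =
    subst (_∈ nacColourings) (sym (cycleCondition⇒colouringOf {c} cc))
      (∈-cartesianProductWith⁺ colouringOf {bools} {nonzeroVecs (m₁ + m₂)}
        (∈-bools _) (nonzeroVecs-complete _ (isNAC⇒nonzero {c} nac)))

  ∈⇒isNAC : ∀ {c} → c ∈ nacColourings → IsNAC G c
  ∈⇒isNAC c∈
    with a , v , _ , v∈ , refl ← ∈-cartesianProductWith⁻ colouringOf bools (nonzeroVecs (m₁ + m₂)) c∈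
    = colouringOf-isNAC a (nonzeroVecs-sound v v∈)

  nacCount : NACCount G (2 * length (nonzeroVecs (m₁ + m₂)))
  nacCount =
    nacColourings ,
    length-cartesianProductWith colouringOf bools (nonzeroVecs (m₁ + m₂)) ,
    cartesianProductWith⁺ colouringOf colouringOf-injective bools-unique (nonzeroVecs-unique (m₁ + m₂)) ,
    λ c → mk⇔ isNAC⇒∈ ∈⇒isNAC

proposition5p2 : (n₁ n₂ : ℕ) → n₁ ≥ 1 → n₂ ≥ 1 →
    ∃[ N ] (NACCount (K n₁ n₂) N × N / 2 ≡ 2 ^ (n₁ + n₂ ∸ 2) ∸ 1)
proposition5p2 (suc m₁) (suc m₂) _ _ = 2 * L , nacCount , (begin
  2 * L / 2                     ≡⟨ cong (_/ 2) (*-comm 2 L) ⟩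
  L * 2 / 2                     ≡⟨ m*n/n≡m L 2 ⟩
  L                             ≡⟨ m+n∸n≡m L 1 ⟨
  L + 1 ∸ 1                     ≡⟨ cong (_∸ 1) (nonzeroVecs-length (m₁ + m₂)) ⟩
  2 ^ (m₁ + m₂) ∸ 1             ≡⟨ cong (λ k → 2 ^ (k ∸ 1) ∸ 1) (+-suc m₁ m₂) ⟨
  2 ^ (suc m₁ + suc m₂ ∸ 2) ∸ 1 ∎)
  where
  open NormalForm m₁ m₂
  open ≡-Reasoning
  L : ℕ
  L = length (nonzeroVecs (m₁ + m₂))
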